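{- Let $\mathcal{F}:\mathbb{F}_{q^t}^r\to\mathbb{F}_q^{rt}$ be a vfr-map and let $\phi\in\Gamma\mathrm{L}(rt,q)$ stabilise every member of the Desarguesian vector space partition of $\mathbb{F}_q^{rt}$ obtained from $\mathcal{F}$. Then $\phi=\mathcal{F}(m_\beta)$ for some $\beta\in\mathbb{F}_{q^t}^*$, where $m_\beta\in\mathrm{GL}(r,q^t)$ is the map $v\mapsto\beta v$.
   Context: A vfr-map $\mathcal{F}:\mathbb{F}_{q^t}^r\to\mathbb{F}_q^{rt}$ is an $\mathbb{F}_q$-linear bijection (e.g. obtained by fixing an $\mathbb{F}_q$-basis of $\mathbb{F}_{q^t}$ and writing coordinates in it). The Desarguesian vector space partition obtained from $\mathcal{F}$ is the set of $t$-dimensional $\mathbb{F}_q$-subspaces $\{\mathcal{F}(\alpha v)\mid\alpha\in\mathbb{F}_{q^t}\}$, $v\in\mathbb{F}_{q^t}^r\setminus\{0\}$. For $\xi\in\Gamma\mathrm{L}(r,q^t)$, $\mathcal{F}(\xi)$ denotes the map on $\mathbb{F}_q^{rt}$ with $\mathcal{F}(\xi)(\mathcal{F}(v))=\mathcal{F}(\xi(v))$. -}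

module Defs where

open import Level using (0ℓ)
open import Data.Nat using (ℕ; _*_; _≥_)
open import Data.Fin using (Fin)
open import Data.Vec using (Vec; map; zipWith; replicate)
open import Data.Product using (Σ; ∃; _×_; _,_)
open import Relation.Binary.PropositionalEquality using (_≡_; _≢_)
open import Algebra.Structures using (IsCommutativeRing)
open import Function.Bundles using (_↔_)
open import Function.Definitions using (Bijective)

record Field : Set₁ where
  infixl 7 _·_
  infixl 6 _+_
  field
    Carrier : Set
    _+_ _·_ : Carrier → Carrier → Carrier
    -_      : Carrier → Carrier
    0# 1#   : Carrier
    isCommutativeRing : IsCommutativeRing _≡_ _+_ _·_ -_ 0# 1#
    0≢1     : 0# ≢ 1#
    inverse : ∀ x → x ≢ 0# → Σ Carrier λ y → x · y ≡ 1#

record FiniteField : Set₁ where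
  field
    field' : Field
    finite : Σ ℕ λ n → Field.Carrier field' ↔ Fin n
  open Field field' public

open Field

record IsFieldHom (k K : Field) (f : Carrier k → Carrier K) : Set where
  field
    hom-+ : ∀ a b → f (_+_ k a b) ≡ _+_ K (f a) (f b)
    hom-· : ∀ a b → f (_·_ k a b) ≡ _·_ K (f a) (f b)
    hom-1 : f (1# k) ≡ 1# K

record IsFieldAut (k : Field) (σ : Carrier k → Carrier k) : Set where
  field
    isHom     : IsFieldHom k k σ
    bijective : Bijective _≡_ _≡_ σ

module _ (k : Field) where
  Vect : ℕ → Set
  Vect n = Vec (Carrier k) n

  vzero : ∀ {n} → Vect n
  vzero = replicate _ (0# k)

  _⊕_ : ∀ {n} → Vect n → Vect n → Vect n
  _⊕_ = zipWith (_+_ k)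

  _⊙_ : ∀ {n} → Carrier k → Vect n → Vect n
  a ⊙ v = map (_·_ k a) v

-- Setting: k = F_q is a finite field, K = F_{q^t} a finite field with an
-- embedding ι : k → K (K is viewed as an extension of k via ι).
module _ (k K : Field) (ι : Carrier k → Carrier K) where

  _⊙ι_ : ∀ {r} → Carrier k → Vect K r → Vect K r
  a ⊙ι v = _⊙_ K (ι a) v

  record IsVfrMap (r t : ℕ) (F : Vect K r → Vect k (r * t)) : Set where
    field
      additive    : ∀ u v → F (_⊕_ K u v) ≡ _⊕_ k (F u) (F v)
      homogeneous : ∀ a v → F (a ⊙ι v) ≡ _⊙_ k a (F v)
      bijective   : Bijective _≡_ _≡_ F

  -- The member of the Desarguesian partition determined by v ∈ K^r \ {0}:
  -- the set { F(α v) | α ∈ K } as a predicate on k^(rt).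
  Member : ∀ {r t} → (Vect K r → Vect k (r * t)) → Vect K r → Vect k (r * t) → Set
  Member F v w = Σ (Carrier K) λ α → w ≡ F (_⊙_ K α v)

  Stabilises : ∀ {n : ℕ} → (Vect k n → Vect k n) → (Vect k n → Set) → Set
  Stabilises {n} φ S = (∀ w → S w → S (φ w)) × (∀ w → S w → Σ (Vect k n) λ u → S u × φ u ≡ w)

  -- φ = F(ξ), i.e. φ (F v) = F (ξ v) for all v.
  IsInduced : ∀ {r t} → (Vect K r → Vect k (r * t)) → (Vect k (r * t) → Vect k (r * t))
              → (Vect K r → Vect K r) → Set
  IsInduced F φ ξ = ∀ v → φ (F v) ≡ F (ξ v)

record IsΓL (k : Field) (n : ℕ) (φ : Vect k n → Vect k n) : Set where
  field
    σ           : Carrier k → Carrier k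
    σ-aut       : IsFieldAut k σ
    additive    : ∀ u v → φ (_⊕_ k u v) ≡ _⊕_ k (φ u) (φ v)
    semilinear  : ∀ a v → φ (_⊙_ k a v) ≡ _⊙_ k (σ a) (φ v)
    bijective   : Bijective _≡_ _≡_ φ

module Submission where

-- Conjugating φ by F gives an additive map A of K^r with φ ∘ F = F ∘ A, and the hypothesis says
-- that every nonzero vector is an eigenvector of A.  If u and v are linearly independent, comparing
-- A (u + v) = c (u + v) with A u + A v = a u + b v forces a = c = b.  For r ≥ 2 every nonzero vector
-- is independent of e₁ or of e₂, which are independent of each other, so all eigenvalues agree.

open import Defs
open import Data.Nat using (ℕ; suc; _*_; _≥_; s≤s)
open import Data.Product using (Σ; _×_; _,_; proj₁; proj₂)
open import Data.Vec using ([]; _∷_; replicate)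
open import Data.Vec.Properties
  using (∷-injectiveˡ; ∷-injectiveʳ; ≡-dec; map-cong; map-id; map-const; map-replicate; map-∘;
         zipWith-identityˡ; zipWith-identityʳ)
open import Data.Fin.Properties using (inj⇒≟)
open import Function.Base using (_∘_)
open import Function.Definitions using (Injective; Bijective)
open import Function.Properties.Inverse using (↔⇒↣)
open import Level using (0ℓ)
open import Relation.Binary.Definitions using (DecidableEquality)
open import Relation.Binary.PropositionalEquality
  using (_≡_; _≢_; refl; sym; trans; cong; cong₂; module ≡-Reasoning)
open import Relation.Nullary using (yes; no)
open import Data.Empty using (⊥-elim)
open import Algebra.Bundles using (CommutativeRing)
open import Algebra.Structures using (IsCommutativeRing)

FiniteField-≟ : (F : FiniteField) → DecidableEquality (FiniteField.Carrier F)
FiniteField-≟ F = inj⇒≟ (↔⇒↣ (proj₂ (FiniteField.finite F)))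

module LinearAlgebra (K : Field) (_≟_ : DecidableEquality (Field.Carrier K)) where
  open Field K
  open IsCommutativeRing isCommutativeRing hiding (refl; sym; trans)
  open ≡-Reasoning

  private
    ring : CommutativeRing 0ℓ 0ℓ
    ring = record { isCommutativeRing = isCommutativeRing }

  open import Algebra.Properties.Ring (CommutativeRing.ring ring) using (-‿distribˡ-*)
  open import Algebra.Properties.AbelianGroup (CommutativeRing.+-abelianGroup ring)
    using (⁻¹-∙-comm; identityˡ-unique; x∙y⁻¹≈ε⇒x≈y)
  open import Algebra.Properties.CommutativeSemigroup (CommutativeRing.+-commutativeSemigroup ring)
    using (interchange)

  x·y≡0⇒x≡0 : ∀ {x y} → y ≢ 0# → x · y ≡ 0# → x ≡ 0#
  x·y≡0⇒x≡0 {x} {y} y≢0 xy≡0 with inverse y y≢0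
  ... | y⁻¹ , yy⁻¹≡1 = begin
    x             ≡⟨ sym (*-identityʳ x) ⟩
    x · 1#        ≡⟨ cong (x ·_) (sym yy⁻¹≡1) ⟩
    x · (y · y⁻¹) ≡⟨ sym (*-assoc x y y⁻¹) ⟩
    (x · y) · y⁻¹ ≡⟨ cong (_· y⁻¹) xy≡0 ⟩
    0# · y⁻¹      ≡⟨ zeroˡ y⁻¹ ⟩
    0#            ∎

  ·-sub-interchange : ∀ c a b x y → (c + - a) · x + (c + - b) · y ≡ c · (x + y) + - (a · x + b · y)
  ·-sub-interchange c a b x y = begin
    (c + - a) · x + (c + - b) · y
      ≡⟨ cong₂ _+_ (distribʳ x c (- a)) (distribʳ y c (- b)) ⟩
    (c · x + - a · x) + (c · y + - b · y)
      ≡⟨ cong₂ (λ p q → (c · x + p) + (c · y + q)) (sym (-‿distribˡ-* a x)) (sym (-‿distribˡ-* b y)) ⟩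
    (c · x + - (a · x)) + (c · y + - (b · y))
      ≡⟨ interchange _ _ _ _ ⟩
    (c · x + c · y) + (- (a · x) + - (b · y))
      ≡⟨ cong₂ _+_ (sym (distribˡ c x y)) (⁻¹-∙-comm _ _) ⟩
    c · (x + y) + - (a · x + b · y)
      ∎

  V : ℕ → Set
  V = Vect K

  infixl 6 _⊕′_
  infixr 7 _⊙′_

  _⊕′_ : ∀ {n} → V n → V n → V n
  _⊕′_ = _⊕_ K

  _⊙′_ : ∀ {n} → Carrier → V n → V n
  _⊙′_ = _⊙_ K

  𝟎 : ∀ {n} → V n
  𝟎 = vzero K

  ⊙-identityˡ : ∀ {n} (v : V n) → 1# ⊙′ v ≡ v
  ⊙-identityˡ v = trans (map-cong *-identityˡ v) (map-id v)

  ⊙-zeroˡ : ∀ {n} (v : V n) → 0# ⊙′ v ≡ 𝟎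
  ⊙-zeroˡ v = trans (map-cong zeroˡ v) (map-const v 0#)

  ⊙-zeroʳ : ∀ {n} a → a ⊙′ 𝟎 {n} ≡ 𝟎
  ⊙-zeroʳ {n} a = trans (map-replicate (a ·_) 0# n) (cong (replicate n) (zeroʳ a))

  ⊙-assoc : ∀ {n} a b (v : V n) → a ⊙′ b ⊙′ v ≡ (a · b) ⊙′ v
  ⊙-assoc a b v = trans (sym (map-∘ (a ·_) (b ·_) v)) (map-cong (sym ∘ *-assoc a b) v)

  ⊕-identityˡ : ∀ {n} (v : V n) → 𝟎 ⊕′ v ≡ v
  ⊕-identityˡ = zipWith-identityˡ +-identityˡ

  ⊕-identityʳ : ∀ {n} (v : V n) → v ⊕′ 𝟎 ≡ v
  ⊕-identityʳ = zipWith-identityʳ +-identityʳ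

  ⊕-idem⇒𝟎 : ∀ {n} (v : V n) → v ⊕′ v ≡ v → v ≡ 𝟎
  ⊕-idem⇒𝟎 []      _ = refl
  ⊕-idem⇒𝟎 (x ∷ v) e = cong₂ _∷_ (identityˡ-unique x x (∷-injectiveˡ e)) (⊕-idem⇒𝟎 v (∷-injectiveʳ e))

  ⊙-sub-interchange : ∀ {n} c a b (u v : V n) → c ⊙′ (u ⊕′ v) ≡ a ⊙′ u ⊕′ b ⊙′ v
                    → (c + - a) ⊙′ u ⊕′ (c + - b) ⊙′ v ≡ 𝟎
  ⊙-sub-interchange c a b []      []      _ = refl
  ⊙-sub-interchange c a b (x ∷ u) (y ∷ v) e = cong₂ _∷_
    (trans (·-sub-interchange c a b x y)
           (trans (cong (_+ - (a · x + b · y)) (∷-injectiveˡ e)) (-‿inverseʳ _)))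
    (⊙-sub-interchange c a b u v (∷-injectiveʳ e))

  ⊙≡𝟎⇒≡0 : ∀ {n} a (v : V n) → v ≢ 𝟎 → a ⊙′ v ≡ 𝟎 → a ≡ 0#
  ⊙≡𝟎⇒≡0 a v v≢𝟎 av≡𝟎 with a ≟ 0#
  ... | yes a≡0 = a≡0
  ... | no a≢0 with inverse a a≢0
  ...   | a⁻¹ , aa⁻¹≡1 = ⊥-elim (v≢𝟎 (begin
    v              ≡⟨ sym (⊙-identityˡ v) ⟩
    1# ⊙′ v        ≡⟨ cong (_⊙′ v) (trans (sym aa⁻¹≡1) (*-comm a a⁻¹)) ⟩
    (a⁻¹ · a) ⊙′ v ≡⟨ sym (⊙-assoc a⁻¹ a v) ⟩
    a⁻¹ ⊙′ a ⊙′ v  ≡⟨ cong (a⁻¹ ⊙′_) av≡𝟎 ⟩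
    a⁻¹ ⊙′ 𝟎       ≡⟨ ⊙-zeroʳ a⁻¹ ⟩
    𝟎              ∎))

  LinearlyIndependent : ∀ {n} → V n → V n → Set
  LinearlyIndependent u v = ∀ a b → a ⊙′ u ⊕′ b ⊙′ v ≡ 𝟎 → a ≡ 0# × b ≡ 0#

  independent⇒sum≢𝟎 : ∀ {n} {u v : V n} → LinearlyIndependent u v → u ⊕′ v ≢ 𝟎
  independent⇒sum≢𝟎 {u = u} {v} ind u+v≡𝟎 =
    0≢1 (sym (proj₁ (ind 1# 1# (trans (cong₂ _⊕′_ (⊙-identityˡ u) (⊙-identityˡ v)) u+v≡𝟎))))

  independent-by-head : ∀ {n x} {u v : V n} → x ≢ 0# → 0# ∷ v ≢ 𝟎
                      → LinearlyIndependent (x ∷ u) (0# ∷ v)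
  independent-by-head {x = x} {u} {v} x≢0 w≢𝟎 a b e = a≡0 , b≡0
    where
    a≡0 : a ≡ 0#
    a≡0 = x·y≡0⇒x≡0 x≢0 (begin
      a · x          ≡⟨ sym (+-identityʳ (a · x)) ⟩
      a · x + 0#     ≡⟨ cong (a · x +_) (sym (zeroʳ b)) ⟩
      a · x + b · 0# ≡⟨ ∷-injectiveˡ e ⟩
      0#             ∎)
    b≡0 : b ≡ 0#
    b≡0 = ⊙≡𝟎⇒≡0 b (0# ∷ v) w≢𝟎 (begin
      b ⊙′ (0# ∷ v)                    ≡⟨ sym (⊕-identityˡ _) ⟩
      𝟎 ⊕′ b ⊙′ (0# ∷ v)               ≡⟨ cong (_⊕′ b ⊙′ (0# ∷ v)) (sym (⊙-zeroˡ (x ∷ u))) ⟩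
      0# ⊙′ (x ∷ u) ⊕′ b ⊙′ (0# ∷ v)   ≡⟨ cong (λ c → c ⊙′ (x ∷ u) ⊕′ b ⊙′ (0# ∷ v)) (sym a≡0) ⟩
      a ⊙′ (x ∷ u) ⊕′ b ⊙′ (0# ∷ v)    ≡⟨ e ⟩
      𝟎                                ∎)

  module AllEigenvectors {n} (A : V n → V n)
    (additive : ∀ u v → A (u ⊕′ v) ≡ A u ⊕′ A v)
    (eigen : ∀ v → v ≢ 𝟎 → Σ Carrier λ α → A v ≡ α ⊙′ v) where

    A𝟎≡𝟎 : A 𝟎 ≡ 𝟎
    A𝟎≡𝟎 = ⊕-idem⇒𝟎 (A 𝟎) (trans (sym (additive 𝟎 𝟎)) (cong A (⊕-identityˡ 𝟎)))

    eigenvalues-agree : ∀ {u v a b} → LinearlyIndependent u v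
                      → A u ≡ a ⊙′ u → A v ≡ b ⊙′ v → a ≡ b
    eigenvalues-agree {u} {v} {a} {b} ind Au≡au Av≡bv with eigen (u ⊕′ v) (independent⇒sum≢𝟎 ind)
    ... | c , A[u+v]≡c[u+v] = trans (sym (x∙y⁻¹≈ε⇒x≈y c a (proj₁ c≡a∧c≡b))) (x∙y⁻¹≈ε⇒x≈y c b (proj₂ c≡a∧c≡b))
      where
      c≡a∧c≡b : c + - a ≡ 0# × c + - b ≡ 0#
      c≡a∧c≡b = ind _ _ (⊙-sub-interchange c a b u v (begin
        c ⊙′ (u ⊕′ v)     ≡⟨ sym A[u+v]≡c[u+v] ⟩
        A (u ⊕′ v)        ≡⟨ additive u v ⟩
        A u ⊕′ A v        ≡⟨ cong₂ _⊕′_ Au≡au Av≡bv ⟩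
        a ⊙′ u ⊕′ b ⊙′ v  ∎))

  1≢0 : 1# ≢ 0#
  1≢0 = 0≢1 ∘ sym

  all-eigenvectors⇒scalar : ∀ {m} (A : V (suc (suc m)) → V (suc (suc m)))
    → (∀ u v → A (u ⊕′ v) ≡ A u ⊕′ A v)
    → (∀ v → v ≢ 𝟎 → Σ Carrier λ α → A v ≡ α ⊙′ v)
    → Σ Carrier λ β → ∀ v → A v ≡ β ⊙′ v
  all-eigenvectors⇒scalar {m} A additive eigen = β , A≡β⊙
    where
    open AllEigenvectors A additive eigen

    e₁ e₂ : V (suc (suc m))
    e₁ = 1# ∷ 0# ∷ 𝟎
    e₂ = 0# ∷ 1# ∷ 𝟎

    e₁≢𝟎 : e₁ ≢ 𝟎
    e₁≢𝟎 = 1≢0 ∘ ∷-injectiveˡ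

    e₂≢𝟎 : e₂ ≢ 𝟎
    e₂≢𝟎 = 1≢0 ∘ ∷-injectiveˡ ∘ ∷-injectiveʳ

    β γ : Carrier
    β = proj₁ (eigen e₁ e₁≢𝟎)
    γ = proj₁ (eigen e₂ e₂≢𝟎)

    Ae₁≡βe₁ : A e₁ ≡ β ⊙′ e₁
    Ae₁≡βe₁ = proj₂ (eigen e₁ e₁≢𝟎)

    Ae₂≡γe₂ : A e₂ ≡ γ ⊙′ e₂
    Ae₂≡γe₂ = proj₂ (eigen e₂ e₂≢𝟎)

    β≡γ : β ≡ γ
    β≡γ = eigenvalues-agree (independent-by-head 1≢0 e₂≢𝟎) Ae₁≡βe₁ Ae₂≡γe₂

    A≡β⊙ : ∀ v → A v ≡ β ⊙′ v
    A≡β⊙ v with ≡-dec _≟_ v 𝟎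
    ... | yes refl = trans A𝟎≡𝟎 (sym (⊙-zeroʳ β))
    A≡β⊙ (x ∷ v) | no w≢𝟎 with eigen (x ∷ v) w≢𝟎 | x ≟ 0#
    ... | α , Aw≡αw | yes refl =
      trans Aw≡αw (cong (_⊙′ (0# ∷ v)) (sym (eigenvalues-agree (independent-by-head 1≢0 w≢𝟎) Ae₁≡βe₁ Aw≡αw)))
    ... | α , Aw≡αw | no x≢0 =
      trans Aw≡αw (cong (_⊙′ (x ∷ v)) (trans (eigenvalues-agree (independent-by-head x≢0 e₂≢𝟎) Aw≡αw Ae₂≡γe₂) (sym β≡γ)))

  injective-scalar≢0 : ∀ {m} (A : V (suc m) → V (suc m)) → Injective _≡_ _≡_ A
                     → ∀ β → (∀ v → A v ≡ β ⊙′ v) → β ≢ 0#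
  injective-scalar≢0 A A-injective β A≡β⊙ refl = 1≢0 (∷-injectiveˡ (A-injective (begin
    A (1# ∷ 𝟎)      ≡⟨ A≡β⊙ _ ⟩
    0# ⊙′ (1# ∷ 𝟎)  ≡⟨ ⊙-zeroˡ _ ⟩
    𝟎               ≡⟨ sym (⊙-zeroʳ 0#) ⟩
    0# ⊙′ 𝟎         ≡⟨ sym (A≡β⊙ 𝟎) ⟩
    A 𝟎             ∎)))

module Conjugate {X Y : Set} (F : X → Y) (F-bijective : Bijective _≡_ _≡_ F) (φ : Y → Y) where
  open ≡-Reasoning

  F-injective : Injective _≡_ _≡_ F
  F-injective = proj₁ F-bijective

  A : X → X
  A x = proj₁ (proj₂ F-bijective (φ (F x)))

  φ∘F≡F∘A : ∀ x → φ (F x) ≡ F (A x)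
  φ∘F≡F∘A x = sym (proj₂ (proj₂ F-bijective (φ (F x))) refl)

  A-homomorphic : ∀ {_∙_ : X → X → X} {_∘′_ : Y → Y → Y}
    → (∀ x y → F (x ∙ y) ≡ F x ∘′ F y) → (∀ x y → φ (x ∘′ y) ≡ φ x ∘′ φ y)
    → ∀ x y → A (x ∙ y) ≡ A x ∙ A y
  A-homomorphic {_∙_} {_∘′_} F-hom φ-hom x y = F-injective (begin
    F (A (x ∙ y))           ≡⟨ sym (φ∘F≡F∘A (x ∙ y)) ⟩
    φ (F (x ∙ y))           ≡⟨ cong φ (F-hom x y) ⟩
    φ (F x ∘′ F y)          ≡⟨ φ-hom (F x) (F y) ⟩
    φ (F x) ∘′ φ (F y)      ≡⟨ cong₂ _∘′_ (φ∘F≡F∘A x) (φ∘F≡F∘A y) ⟩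
    F (A x) ∘′ F (A y)      ≡⟨ sym (F-hom (A x) (A y)) ⟩
    F (A x ∙ A y)           ∎)

  A-injective : Injective _≡_ _≡_ φ → Injective _≡_ _≡_ A
  A-injective φ-injective {x} {y} Ax≡Ay =
    F-injective (φ-injective (trans (φ∘F≡F∘A x) (trans (cong F Ax≡Ay) (sym (φ∘F≡F∘A y)))))

theorem2p6 : (Fq Fqt : FiniteField) (ι : FiniteField.Carrier Fq → FiniteField.Carrier Fqt)
             → IsFieldHom (FiniteField.field' Fq) (FiniteField.field' Fqt) ι
             → (r t : ℕ) → r ≥ 2
             → (F : Vect (FiniteField.field' Fqt) r → Vect (FiniteField.field' Fq) (r * t))
             → IsVfrMap (FiniteField.field' Fq) (FiniteField.field' Fqt) ι r t F
             → (φ : Vect (FiniteField.field' Fq) (r * t) → Vect (FiniteField.field' Fq) (r * t))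
             → IsΓL (FiniteField.field' Fq) (r * t) φ
             → (∀ v → v ≢ vzero (FiniteField.field' Fqt)
                  → Stabilises (FiniteField.field' Fq) (FiniteField.field' Fqt) ι φ (Member (FiniteField.field' Fq) (FiniteField.field' Fqt) ι F v))
             → Σ (FiniteField.Carrier Fqt) λ β → (β ≢ FiniteField.0# Fqt)
                  × IsInduced (FiniteField.field' Fq) (FiniteField.field' Fqt) ι F φ (_⊙_ (FiniteField.field' Fqt) β)
theorem2p6 Fq Fqt ι _ .(suc (suc _)) t (s≤s (s≤s _)) F vfr φ γl stabilises =
  β , injective-scalar≢0 A (A-injective (proj₁ (IsΓL.bijective γl))) β A≡β⊙ , φ∘F≡F∘β⊙
  where
  open LinearAlgebra (FiniteField.field' Fqt) (FiniteField-≟ Fqt)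
  open Conjugate F (IsVfrMap.bijective vfr) φ

  A-eigen : ∀ v → v ≢ 𝟎 → Σ (FiniteField.Carrier Fqt) λ α → A v ≡ α ⊙′ v
  A-eigen v v≢𝟎 with proj₁ (stabilises v v≢𝟎) (F v) (_ , cong F (sym (⊙-identityˡ v)))
  ... | α , φFv≡F[αv] = α , F-injective (trans (sym (φ∘F≡F∘A v)) φFv≡F[αv])

  A-scalar : Σ (FiniteField.Carrier Fqt) λ β → ∀ v → A v ≡ β ⊙′ v
  A-scalar = all-eigenvectors⇒scalar A (A-homomorphic (IsVfrMap.additive vfr) (IsΓL.additive γl)) A-eigen

  β : FiniteField.Carrier Fqt
  β = proj₁ A-scalar

  A≡β⊙ : ∀ v → A v ≡ β ⊙′ v
  A≡β⊙ = proj₂ A-scalar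

  φ∘F≡F∘β⊙ : ∀ v → φ (F v) ≡ F (β ⊙′ v)
  φ∘F≡F∘β⊙ v = trans (φ∘F≡F∘A v) (cong F (A≡β⊙ v))
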